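{- Let $p$ be an odd prime and let $F(p,1) = (a_{i,j})_{0\le i,j\le p-1}$. Then: (1) for all $0\le k\le p-1$, $a_{p-1,k} = (-1)^k$; (2) for all $0\le n,k\le p-1$, $a_{n,k} = (-1)^n a_{n,p-1-k}$; (3) every element of the cross $C = \{(\tfrac{p-1}{2}, i),\ (i,\tfrac{p-1}{2}) : 0\le i\le p-1,\ i \text{ odd}\}$ is a zero of $F(p,1)$, i.e. $a_{(p-1)/2,i} = a_{i,(p-1)/2} = 0$ for all odd $i$ with $0\le i\le p-1$.
   Context: $F(p,1) = (a_{i,j})_{0\le i,j\le p-1}$ is the $p\times p$ matrix over $\mathbb{F}_p$ with $a_{i,0} = a_{0,j}=1$ and $a_{i,j} = a_{i-1,j} + a_{i-1,j-1} + a_{i,j-1}$ for $i,j\ge1$ (the Delannoy numbers reduced modulo $p$). -}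

module Defs where

open import Data.Nat using (ℕ; zero; suc)
open import Data.Integer using (ℤ; +_; _-_; _*_; -_)
open import Data.Integer.Divisibility using (_∣_)

delannoy : ℕ → ℕ → ℤ
delannoy zero    _       = + 1
delannoy (suc i) zero    = + 1
delannoy (suc i) (suc j) =
  Data.Integer._+_ (Data.Integer._+_ (delannoy i (suc j)) (delannoy i j)) (delannoy (suc i) j)

_≡_[mod_] : ℤ → ℤ → ℕ → Set
x ≡ y [mod p ] = (+ p) ∣ (x - y)

neg1^ : ℕ → ℤ
neg1^ zero    = + 1
neg1^ (suc k) = - (neg1^ k)

open import Data.Nat using (_%_)
import Relation.Binary.PropositionalEquality as Eq
IsOdd : ℕ → Set
IsOdd n = n % 2 Eq.≡ 1

{-# OPTIONS --safe #-}
module Submission where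

-- Modulo a prime p = 1 + L, the recurrence determines an array on [0, L]² from its boundary
-- values. The array c(n, k) = [xᵏ] (1 + x)ⁿ (1 - x)ᴸ⁻ⁿ satisfies the Delannoy recurrence,
-- with c(n, 0) = 1 and c(0, k) = (-1)ᵏ C(L, k) ≡ 1, so D ≡ c. Row L of c is (1 + x)ᴸ,
-- whose coefficients C(L, k) are ≡ (-1)ᵏ; for odd p the middle row is (1 - x²)ᴸᐟ², which
-- has no odd coefficients. Finally (-1)ⁿ D(n, L - k) satisfies the same recurrence and, by
-- the last row and symmetry of D, the same boundary conditions.

open import Defs
open import Data.Nat using (ℕ; _≤_; _∸_; _/_)
open import Data.Nat.Primality using (Prime)
open import Data.Product using (_×_)
open import Data.Integer using (ℤ; +_; _*_)

open import Data.Nat as ℕ using (zero; suc; _<_; s≤s)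
import Data.Nat.Properties as ℕ
open import Data.Nat.Combinatorics using (_C_; nC1≡n; nCk+nC[k+1]≡[n+1]C[k+1])
open import Data.Nat.Divisibility as ℕ using (m∣m*n; ∣⇒≤)
open import Data.Nat.DivMod using (m≡m%n+[m/n]*n; m*n/n≡m)
open import Data.Nat.Primality using (euclidsLemma)
open import Data.Integer using (_+_; _-_; -_)
import Data.Integer.Properties as ℤ
open import Data.Integer.Divisibility.Signed as Signed
  using (∣ᵤ⇒∣; ∣⇒∣ᵤ; ∣m∣n⇒∣m+n; ∣m⇒∣-m; ∣n⇒∣m*n)
open import Data.Integer.Tactic.RingSolver using (solve-∀)
open import Data.Product using (_,_)
open import Data.Sum using (inj₁; inj₂)
open import Data.Empty using (⊥-elim)
open import Relation.Binary.Bundles using (Setoid)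
import Relation.Binary.Reasoning.Setoid
open import Relation.Binary.PropositionalEquality
  using (_≡_; refl; sym; trans; cong; cong₂; subst; module ≡-Reasoning)

-- _≡_[mod_] unfolds to a divisibility of |x - y|, from which Agda cannot infer x and y;
-- this wrapper keeps them as indices.
infix 4 _≈_⟨mod_⟩

record _≈_⟨mod_⟩ (x y : ℤ) (p : ℕ) : Set where
  constructor mod
  field unmod : x ≡ y [mod p ]
open _≈_⟨mod_⟩

private
  [x-y]+[y-z]≡x-z : ∀ x y z → (x - y) + (y - z) ≡ x - z
  [x-y]+[y-z]≡x-z = solve-∀

  [x-y]+[u-v]≡[x+u]-[y+v] : ∀ x y u v → (x - y) + (u - v) ≡ (x + u) - (y + v)
  [x-y]+[u-v]≡[x+u]-[y+v] = solve-∀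

module _ {p : ℕ} where

  private
    fromSigned : ∀ {x y d} → d ≡ x - y → (+ p) Signed.∣ d → x ≈ y ⟨mod p ⟩
    fromSigned eq h = mod (∣⇒∣ᵤ (subst ((+ p) Signed.∣_) eq h))

    toSigned : ∀ {x y} → x ≈ y ⟨mod p ⟩ → (+ p) Signed.∣ (x - y)
    toSigned (mod h) = ∣ᵤ⇒∣ h

  ≡⇒≈-mod : ∀ {x y} → x ≡ y → x ≈ y ⟨mod p ⟩
  ≡⇒≈-mod {x} refl = fromSigned (sym (ℤ.+-inverseʳ x)) (Signed.divides (+ 0) refl)

  ≈-mod-sym : ∀ {x y} → x ≈ y ⟨mod p ⟩ → y ≈ x ⟨mod p ⟩
  ≈-mod-sym {x} {y} h = fromSigned (-[x-y]≡y-x x y) (∣m⇒∣-m (toSigned h))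
    where
    -[x-y]≡y-x : ∀ x y → - (x - y) ≡ y - x
    -[x-y]≡y-x = solve-∀

  ≈-mod-trans : ∀ {x y z} → x ≈ y ⟨mod p ⟩ → y ≈ z ⟨mod p ⟩ → x ≈ z ⟨mod p ⟩
  ≈-mod-trans {x} {y} {z} h k =
    fromSigned ([x-y]+[y-z]≡x-z x y z) (∣m∣n⇒∣m+n (toSigned h) (toSigned k))

  +-cong-mod : ∀ {x y u v} → x ≈ y ⟨mod p ⟩ → u ≈ v ⟨mod p ⟩ → x + u ≈ y + v ⟨mod p ⟩
  +-cong-mod {x} {y} {u} {v} h k =
    fromSigned ([x-y]+[u-v]≡[x+u]-[y+v] x y u v) (∣m∣n⇒∣m+n (toSigned h) (toSigned k))

  -‿cong-mod : ∀ {x y} → x ≈ y ⟨mod p ⟩ → - x ≈ - y ⟨mod p ⟩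
  -‿cong-mod {x} {y} h = fromSigned (-[x-y]≡-x--y x y) (∣m⇒∣-m (toSigned h))
    where
    -[x-y]≡-x--y : ∀ x y → - (x - y) ≡ - x - - y
    -[x-y]≡-x--y = solve-∀

  *-congˡ-mod : ∀ c {x y} → x ≈ y ⟨mod p ⟩ → c * x ≈ c * y ⟨mod p ⟩
  *-congˡ-mod c {x} {y} h = fromSigned (*-distribˡ-- c x y) (∣n⇒∣m*n c (toSigned h))
    where
    *-distribˡ-- : ∀ c x y → c * (x - y) ≡ c * x - c * y
    *-distribˡ-- = solve-∀

  ∣⇒≈-mod-0 : ∀ {n} → p ℕ.∣ n → + n ≈ + 0 ⟨mod p ⟩
  ∣⇒≈-mod-0 {n} h = fromSigned (sym (ℤ.+-identityʳ (+ n))) (∣ᵤ⇒∣ h)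

  ≈-mod-setoid : Setoid _ _
  ≈-mod-setoid = record
    { Carrier       = ℤ
    ; _≈_           = λ x y → x ≈ y ⟨mod p ⟩
    ; isEquivalence = record { refl = ≡⇒≈-mod refl ; sym = ≈-mod-sym ; trans = ≈-mod-trans }
    }

DelannoyRecurrence : ℕ → (ℕ → ℕ → ℤ) → Set
DelannoyRecurrence L f = ∀ n k → n < L → k < L →
  f (suc n) (suc k) ≡ f n (suc k) + f n k + f (suc n) k

delannoy-unique-mod : ∀ {p} L (f : ℕ → ℕ → ℤ) → DelannoyRecurrence L f →
  (∀ k → k ≤ L → f 0 k ≈ + 1 ⟨mod p ⟩) → (∀ n → n ≤ L → f n 0 ≈ + 1 ⟨mod p ⟩) →
  ∀ n k → n ≤ L → k ≤ L → delannoy n k ≈ f n k ⟨mod p ⟩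
delannoy-unique-mod L f rec row₀ col₀ = go
  where
  go : ∀ n k → n ≤ L → k ≤ L → delannoy n k ≈ f n k ⟨mod _ ⟩
  go zero    k       _   k≤L = ≈-mod-sym (row₀ k k≤L)
  go (suc n) zero    n<L _   = ≈-mod-sym (col₀ (suc n) n<L)
  go (suc n) (suc k) n<L k<L =
    subst (delannoy (suc n) (suc k) ≈_⟨mod _ ⟩) (sym (rec n k n<L k<L))
      (+-cong-mod (+-cong-mod (go n (suc k) (ℕ.<⇒≤ n<L) k<L) (go n k (ℕ.<⇒≤ n<L) (ℕ.<⇒≤ k<L)))
                  (go (suc n) k n<L (ℕ.<⇒≤ k<L)))

delannoy-comm : ∀ n k → delannoy n k ≡ delannoy k n
delannoy-comm zero    zero    = refl
delannoy-comm zero    (suc k) = refl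
delannoy-comm (suc n) zero    = refl
delannoy-comm (suc n) (suc k) = begin
  delannoy n (suc k) + delannoy n k + delannoy (suc n) k
    ≡⟨ cong₂ _+_ (cong₂ _+_ (delannoy-comm n (suc k)) (delannoy-comm n k)) (delannoy-comm (suc n) k) ⟩
  delannoy (suc k) n + delannoy k n + delannoy k (suc n)
    ≡⟨ a+b+c≡c+b+a (delannoy (suc k) n) (delannoy k n) (delannoy k (suc n)) ⟩
  delannoy k (suc n) + delannoy k n + delannoy (suc k) n
    ∎
  where
  open ≡-Reasoning
  a+b+c≡c+b+a : ∀ a b c → a + b + c ≡ c + b + a
  a+b+c≡c+b+a = solve-∀

[1+k]*[1+n]C[1+k]≡[1+n]*nCk : ∀ n k → suc k ℕ.* (suc n C suc k) ≡ suc n ℕ.* (n C k)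
[1+k]*[1+n]C[1+k]≡[1+n]*nCk n zero =
  trans (ℕ.+-identityʳ (suc n C 1)) (trans (nC1≡n (suc n)) (sym (ℕ.*-identityʳ (suc n))))
[1+k]*[1+n]C[1+k]≡[1+n]*nCk zero (suc k) = ℕ.*-zeroʳ (2 ℕ.+ k)
[1+k]*[1+n]C[1+k]≡[1+n]*nCk (suc n) (suc k) = begin
  (2 ℕ.+ k) ℕ.* (suc (suc n) C suc (suc k))
    ≡⟨ cong ((2 ℕ.+ k) ℕ.*_) (nCk+nC[k+1]≡[n+1]C[k+1] (suc n) (suc k)) ⟨
  (2 ℕ.+ k) ℕ.* (A ℕ.+ B)
    ≡⟨ ℕ.*-distribˡ-+ (2 ℕ.+ k) A B ⟩
  (A ℕ.+ suc k ℕ.* A) ℕ.+ (2 ℕ.+ k) ℕ.* B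
    ≡⟨ ℕ.+-assoc A (suc k ℕ.* A) _ ⟩
  A ℕ.+ (suc k ℕ.* A ℕ.+ (2 ℕ.+ k) ℕ.* B)
    ≡⟨ cong (A ℕ.+_) (cong₂ ℕ._+_ ([1+k]*[1+n]C[1+k]≡[1+n]*nCk n k)
                                   ([1+k]*[1+n]C[1+k]≡[1+n]*nCk n (suc k))) ⟩
  A ℕ.+ (suc n ℕ.* (n C k) ℕ.+ suc n ℕ.* (n C suc k))
    ≡⟨ cong (A ℕ.+_) (ℕ.*-distribˡ-+ (suc n) (n C k) (n C suc k)) ⟨
  A ℕ.+ suc n ℕ.* (n C k ℕ.+ n C suc k)
    ≡⟨ cong (λ m → A ℕ.+ suc n ℕ.* m) (nCk+nC[k+1]≡[n+1]C[k+1] n k) ⟩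
  (2 ℕ.+ n) ℕ.* A
    ∎
  where
  open ≡-Reasoning
  A = suc n C suc k
  B = suc n C suc (suc k)

prime⇒[1+n]∣[1+n]C[1+k] : ∀ {n k} → Prime (suc n) → k < n → suc n ℕ.∣ suc n C suc k
prime⇒[1+n]∣[1+n]C[1+k] {n} {k} p-prime k<n
  with euclidsLemma (suc k) (suc n C suc k) p-prime
         (subst (suc n ℕ.∣_) (sym ([1+k]*[1+n]C[1+k]≡[1+n]*nCk n k)) (m∣m*n (n C k)))
... | inj₁ [1+n]∣[1+k] = ⊥-elim (ℕ.<⇒≱ (s≤s k<n) (∣⇒≤ [1+n]∣[1+k]))
... | inj₂ [1+n]∣C     = [1+n]∣C

-- Since n C k + n C (1 + k) = (1 + n) C (1 + k) vanishes modulo the prime 1 + n,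
-- the signs alternate along row n.
prime⇒nCk≈-1^k : ∀ {n k} → Prime (suc n) → k ≤ n → + (n C k) ≈ neg1^ k ⟨mod suc n ⟩
prime⇒nCk≈-1^k {n} {zero}  p-prime _   = ≡⇒≈-mod refl
prime⇒nCk≈-1^k {n} {suc k} p-prime k<n = begin
  + (n C suc k)
    ≡⟨ [a+b]-a≡b (+ (n C k)) (+ (n C suc k)) ⟨
  (+ (n C k) + + (n C suc k)) - + (n C k)
    ≡⟨ cong (_- + (n C k)) (ℤ.pos-+ (n C k) (n C suc k)) ⟨
  + (n C k ℕ.+ n C suc k) - + (n C k)
    ≡⟨ cong (λ m → + m - + (n C k)) (nCk+nC[k+1]≡[n+1]C[k+1] n k) ⟩
  + (suc n C suc k) - + (n C k)
    ≈⟨ +-cong-mod (∣⇒≈-mod-0 (prime⇒[1+n]∣[1+n]C[1+k] p-prime k<n))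
                  (-‿cong-mod (prime⇒nCk≈-1^k p-prime (ℕ.<⇒≤ k<n))) ⟩
  + 0 - neg1^ k
    ≡⟨ ℤ.+-identityˡ (- neg1^ k) ⟩
  neg1^ (suc k)
    ∎
  where
  open Relation.Binary.Reasoning.Setoid ≈-mod-setoid
  [a+b]-a≡b : ∀ a b → (a + b) - a ≡ b
  [a+b]-a≡b = solve-∀

neg1^-square : ∀ n → neg1^ n * neg1^ n ≡ + 1
neg1^-square zero    = refl
neg1^-square (suc n) = trans (-s*-s≡s*s (neg1^ n)) (neg1^-square n)
  where
  -s*-s≡s*s : ∀ s → - s * - s ≡ s * s
  -s*-s≡s*s = solve-∀

shift : (ℕ → ℤ) → ℕ → ℤ
shift f zero    = + 0
shift f (suc k) = f k

-- coeff a b k is the coefficient of xᵏ in (1 + x)ᵃ (1 - x)ᵇ; shift is multiplication by x.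
coeff : ℕ → ℕ → ℕ → ℤ
coeff zero    zero    zero    = + 1
coeff zero    zero    (suc k) = + 0
coeff zero    (suc b) k       = coeff 0 b k - shift (coeff 0 b) k
coeff (suc a) b       k       = coeff a b k + shift (coeff a b) k

coeff-zero : ∀ a b → coeff a b 0 ≡ + 1
coeff-zero zero    zero    = refl
coeff-zero zero    (suc b) = cong (_- + 0) (coeff-zero 0 b)
coeff-zero (suc a) b       = cong (_+ + 0) (coeff-zero a b)

coeff-sucʳ : ∀ a b k → coeff a (suc b) k ≡ coeff a b k - shift (coeff a b) k
coeff-sucʳ zero    b k       = refl
coeff-sucʳ (suc a) b zero    =
  trans (cong (_+ + 0) (coeff-sucʳ a b 0)) ([x-z]+z≡[x+z]-z (coeff a b 0) (+ 0))
  where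
  [x-z]+z≡[x+z]-z : ∀ x z → (x - z) + z ≡ (x + z) - z
  [x-z]+z≡[x+z]-z = solve-∀
coeff-sucʳ (suc a) b (suc k) =
  trans (cong₂ _+_ (coeff-sucʳ a b (suc k)) (coeff-sucʳ a b k))
        ([x-y]+[u-v]≡[x+u]-[y+v] (coeff a b (suc k)) (coeff a b k)
                                 (coeff a b k) (shift (coeff a b) k))

coeff-zeroʳ : ∀ a k → coeff a 0 k ≡ + (a C k)
coeff-zeroʳ zero    zero    = refl
coeff-zeroʳ zero    (suc k) = refl
coeff-zeroʳ (suc a) zero    = cong (_+ + 0) (coeff-zeroʳ a 0)
coeff-zeroʳ (suc a) (suc k) = begin
  coeff a 0 (suc k) + coeff a 0 k  ≡⟨ cong₂ _+_ (coeff-zeroʳ a (suc k)) (coeff-zeroʳ a k) ⟩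
  + (a C suc k) + + (a C k)        ≡⟨ ℤ.+-comm (+ (a C suc k)) (+ (a C k)) ⟩
  + (a C k) + + (a C suc k)        ≡⟨ ℤ.pos-+ (a C k) (a C suc k) ⟨
  + (a C k ℕ.+ a C suc k)          ≡⟨ cong +_ (nCk+nC[k+1]≡[n+1]C[k+1] a k) ⟩
  + (suc a C suc k)                ∎
  where open ≡-Reasoning

coeff-zeroˡ : ∀ b k → coeff 0 b k ≡ neg1^ k * + (b C k)
coeff-zeroˡ zero    zero    = refl
coeff-zeroˡ zero    (suc k) = sym (ℤ.*-zeroʳ (neg1^ (suc k)))
coeff-zeroˡ (suc b) zero    = cong (_- + 0) (coeff-zero 0 b)
coeff-zeroˡ (suc b) (suc k) = begin
  coeff 0 b (suc k) - coeff 0 b k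
    ≡⟨ cong₂ _-_ (coeff-zeroˡ b (suc k)) (coeff-zeroˡ b k) ⟩
  - neg1^ k * + (b C suc k) - neg1^ k * + (b C k)
    ≡⟨ -s*y-s*x≡-s*[x+y] (neg1^ k) (+ (b C k)) (+ (b C suc k)) ⟩
  - neg1^ k * (+ (b C k) + + (b C suc k))
    ≡⟨ cong (λ m → - neg1^ k * m) (ℤ.pos-+ (b C k) (b C suc k)) ⟨
  - neg1^ k * + (b C k ℕ.+ b C suc k)
    ≡⟨ cong (λ m → - neg1^ k * + m) (nCk+nC[k+1]≡[n+1]C[k+1] b k) ⟩
  - neg1^ k * + (suc b C suc k)
    ∎
  where
  open ≡-Reasoning
  -s*y-s*x≡-s*[x+y] : ∀ s x y → - s * y - s * x ≡ - s * (x + y)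
  -s*y-s*x≡-s*[x+y] = solve-∀

coeff-suc-suc : ∀ a b k → coeff (suc a) (suc b) k ≡ coeff a b k - shift (shift (coeff a b)) k
coeff-suc-suc a b zero    = trans (ℤ.+-identityʳ (coeff a (suc b) 0)) (coeff-sucʳ a b 0)
coeff-suc-suc a b (suc k) =
  trans (cong₂ _+_ (coeff-sucʳ a b (suc k)) (coeff-sucʳ a b k))
        ([x-y]+[y-z]≡x-z (coeff a b (suc k)) (coeff a b k) (shift (coeff a b) k))

coeff-diag-odd : ∀ a j → coeff a a (suc (j ℕ.* 2)) ≡ + 0
coeff-diag-odd zero    j       = refl
coeff-diag-odd (suc a) zero    = trans (coeff-suc-suc a a 1) (cong (_- + 0) (coeff-diag-odd a 0))
coeff-diag-odd (suc a) (suc j) =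
  trans (coeff-suc-suc a a _) (cong₂ _-_ (coeff-diag-odd a (suc j)) (coeff-diag-odd a j))

coeff-delannoy-step : ∀ a b k →
  coeff (suc a) b (suc k) ≡ coeff a (suc b) (suc k) + coeff a (suc b) k + coeff (suc a) b k
coeff-delannoy-step a b k = sym (begin
  coeff a (suc b) (suc k) + coeff a (suc b) k + (P k + shift P k)
    ≡⟨ cong₂ (λ u v → u + v + (P k + shift P k)) (coeff-sucʳ a b (suc k)) (coeff-sucʳ a b k) ⟩
  (P (suc k) - P k) + (P k - shift P k) + (P k + shift P k)
    ≡⟨ [x-y]+[y-z]+[y+z]≡x+y (P (suc k)) (P k) (shift P k) ⟩
  P (suc k) + P k
    ∎)
  where
  open ≡-Reasoning
  P = coeff a b
  [x-y]+[y-z]+[y+z]≡x+y : ∀ x y z → (x - y) + (y - z) + (y + z) ≡ x + y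
  [x-y]+[y-z]+[y+z]≡x+y = solve-∀

m∸n≡1+m∸[1+n] : ∀ {m n} → n < m → m ∸ n ≡ suc (m ∸ suc n)
m∸n≡1+m∸[1+n] n<m = ℕ.+-∸-assoc 1 n<m

module _ {L : ℕ} (p-prime : Prime (suc L)) where

  private
    open Relation.Binary.Reasoning.Setoid (≈-mod-setoid {suc L})

  delannoy≈coeff : ∀ n k → n ≤ L → k ≤ L → delannoy n k ≈ coeff n (L ∸ n) k ⟨mod suc L ⟩
  delannoy≈coeff = delannoy-unique-mod L (λ n → coeff n (L ∸ n)) rec row₀ col₀
    where
    rec : DelannoyRecurrence L (λ n → coeff n (L ∸ n))
    rec n k n<L _ rewrite m∸n≡1+m∸[1+n] n<L = coeff-delannoy-step n (L ∸ suc n) k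

    row₀ : ∀ k → k ≤ L → coeff 0 L k ≈ + 1 ⟨mod suc L ⟩
    row₀ k k≤L = begin
      coeff 0 L k               ≡⟨ coeff-zeroˡ L k ⟩
      neg1^ k * + (L C k)       ≈⟨ *-congˡ-mod (neg1^ k) (prime⇒nCk≈-1^k p-prime k≤L) ⟩
      neg1^ k * neg1^ k         ≡⟨ neg1^-square k ⟩
      + 1                       ∎

    col₀ : ∀ n → n ≤ L → coeff n (L ∸ n) 0 ≈ + 1 ⟨mod suc L ⟩
    col₀ n _ = ≡⇒≈-mod (coeff-zero n (L ∸ n))

  delannoy-last-row : ∀ k → k ≤ L → delannoy L k ≈ neg1^ k ⟨mod suc L ⟩
  delannoy-last-row k k≤L = begin
    delannoy L k              ≈⟨ delannoy≈coeff L k ℕ.≤-refl k≤L ⟩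
    coeff L (L ∸ L) k         ≡⟨ cong (λ b → coeff L b k) (ℕ.n∸n≡0 L) ⟩
    coeff L 0 k               ≡⟨ coeff-zeroʳ L k ⟩
    + (L C k)                 ≈⟨ prime⇒nCk≈-1^k p-prime k≤L ⟩
    neg1^ k                   ∎

  delannoy-reflect : ∀ n k → n ≤ L → k ≤ L →
    delannoy n k ≈ neg1^ n * delannoy n (L ∸ k) ⟨mod suc L ⟩
  delannoy-reflect = delannoy-unique-mod L reflected rec row₀ col₀
    where
    reflected : ℕ → ℕ → ℤ
    reflected n k = neg1^ n * delannoy n (L ∸ k)

    signed-step : ∀ n m → neg1^ (suc n) * delannoy (suc n) m ≡
      neg1^ n * delannoy n m + neg1^ n * delannoy n (suc m)
        + neg1^ (suc n) * delannoy (suc n) (suc m)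
    signed-step n m =
      sym (cancel (neg1^ n) (delannoy n m) (delannoy n (suc m)) (delannoy (suc n) m))
      where
      cancel : ∀ s a b d → s * a + s * b + - s * (b + a + d) ≡ - s * d
      cancel = solve-∀

    rec : DelannoyRecurrence L reflected
    rec n k _ k<L rewrite m∸n≡1+m∸[1+n] k<L = signed-step n (L ∸ suc k)

    row₀ : ∀ k → k ≤ L → reflected 0 k ≈ + 1 ⟨mod suc L ⟩
    row₀ k _ = ≡⇒≈-mod refl

    col₀ : ∀ n → n ≤ L → reflected n 0 ≈ + 1 ⟨mod suc L ⟩
    col₀ n n≤L = begin
      neg1^ n * delannoy n L    ≡⟨ cong (neg1^ n *_) (delannoy-comm n L) ⟩
      neg1^ n * delannoy L n    ≈⟨ *-congˡ-mod (neg1^ n) (delannoy-last-row n n≤L) ⟩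
      neg1^ n * neg1^ n         ≡⟨ neg1^-square n ⟩
      + 1                       ∎

odd⇒≡1+[n/2]*2 : ∀ {n} → IsOdd n → n ≡ suc (n / 2 ℕ.* 2)
odd⇒≡1+[n/2]*2 {n} n-odd = trans (m≡m%n+[m/n]*n n 2) (cong (ℕ._+ n / 2 ℕ.* 2) n-odd)

delannoy-middle-odd : ∀ t → Prime (suc (t ℕ.* 2)) → ∀ i → i ≤ t ℕ.* 2 → IsOdd i →
  delannoy t i ≈ + 0 ⟨mod suc (t ℕ.* 2) ⟩
delannoy-middle-odd t p-prime i i≤2t i-odd = begin
  delannoy t i                     ≈⟨ delannoy≈coeff p-prime t i t≤2t i≤2t ⟩
  coeff t (t ℕ.* 2 ∸ t) i          ≡⟨ cong (λ b → coeff t b i) 2t∸t≡t ⟩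
  coeff t t i                      ≡⟨ cong (coeff t t) (odd⇒≡1+[n/2]*2 i-odd) ⟩
  coeff t t (suc (i / 2 ℕ.* 2))    ≡⟨ coeff-diag-odd t (i / 2) ⟩
  + 0                              ∎
  where
  open Relation.Binary.Reasoning.Setoid ≈-mod-setoid
  2t≡t+t : t ℕ.* 2 ≡ t ℕ.+ t
  2t≡t+t = trans (ℕ.*-comm t 2) (cong (t ℕ.+_) (ℕ.*-identityˡ t))
  t≤2t : t ≤ t ℕ.* 2
  t≤2t = subst (t ≤_) (sym 2t≡t+t) (ℕ.m≤m+n t t)
  2t∸t≡t : t ℕ.* 2 ∸ t ≡ t
  2t∸t≡t = trans (cong (_∸ t) 2t≡t+t) (ℕ.m+n∸n≡m t t)

corollary5p7 : (p : ℕ) → Prime p → IsOdd p →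
    ((k : ℕ) → k ≤ p ∸ 1 → delannoy (p ∸ 1) k ≡ neg1^ k [mod p ])
    × ((n k : ℕ) → n ≤ p ∸ 1 → k ≤ p ∸ 1 →
        delannoy n k ≡ neg1^ n * delannoy n (p ∸ 1 ∸ k) [mod p ])
    × ((i : ℕ) → i ≤ p ∸ 1 → IsOdd i →
        (delannoy ((p ∸ 1) / 2) i ≡ + 0 [mod p ])
        × (delannoy i ((p ∸ 1) / 2) ≡ + 0 [mod p ]))
corollary5p7 p p-prime p-odd with p / 2 | odd⇒≡1+[n/2]*2 {p} p-odd
... | t | refl rewrite m*n/n≡m t 2 ⦃ _ ⦄ =
    (λ k k≤L → unmod (delannoy-last-row p-prime k k≤L))
  , (λ n k n≤L k≤L → unmod (delannoy-reflect p-prime n k n≤L k≤L))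
  , λ i i≤L i-odd →
      let middle-row = delannoy-middle-odd t p-prime i i≤L i-odd
      in unmod middle-row , subst (_≡ + 0 [mod p ]) (delannoy-comm t i) (unmod middle-row)
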